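{- Let $\tau=(H,\succ)$ be a finite tree poset with $n=|H|$ elements, exactly one maximal element, and maximum degree $d$, accessible through a comparison oracle, and let $r\in H$. The following algorithm GET-SUBTREES-OF-CHILDREN correctly outputs the list of subtrees $Sub_x$ of all children $x$ of $r$, in $O(dn)$ time: set $S\gets\{x\in H: r\succ x\}$ and $C\gets[\,]$; while $S\neq\emptyset$: compute a maximal element $x$ of $S$ by scanning $S=\{s_1,\dots,s_m\}$ with $x\gets s_1$ and, for $i=2,\dots,m$, $x\gets s_i$ whenever $s_i\succ x$; let $X\gets\{x\}\cup\{y\in S: x\succ y\}$; append $X$ to $C$; set $S\gets S\setminus X$. Return $C$.
   Context: A tree is a poset $(H,\succ)$ (irreflexive, transitive, antisymmetric) such that for every $t\in H$ the set $\{s: s\succ t\}$ is well-ordered by $\succ$. A child of $x$ is $y$ with $x\succ y$ and no $z$ with $x\succ z\succ y$. The maximum degree $d$ is the maximum over the number of maximal elements and the numbers of children of elements. $Sub_t=\{t\}\cup\{s: t\succ s\}$. The comparison oracle answers whether $i\succ j$, $j\succ i$, or they are incomparable in $O(1)$ time. -}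

module Defs where

open import Level using (0ℓ)
open import Data.Nat using (ℕ; zero; suc; _+_; _*_; _⊔_)
open import Data.Fin using (Fin)
open import Data.Fin.Properties using (any?; all?) renaming (_≟_ to _≟F_)
open import Data.List using (List; []; _∷_; length; filter; map; foldr; allFin)
open import Data.List.Relation.Unary.Unique.Propositional using (Unique)
open import Data.List.Membership.Propositional using (_∈_)
open import Data.List.Relation.Binary.Pointwise using (Pointwise)
open import Data.Product using (_×_; _,_; ∃; ∃-syntax; proj₁; proj₂)
open import Data.Product.Properties using ()
open import Data.Sum using (_⊎_)
open import Data.Empty using (⊥)
open import Relation.Nullary using (¬_; Dec; yes; no; does)
open import Relation.Nullary.Decidable using (_×-dec_; ¬?)
open import Relation.Binary using (Rel; Decidable)
open import Relation.Binary.PropositionalEquality using (_≡_)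
open import Function.Bundles using (_⇔_)
open import Data.Bool using (true; false)

-- A set P (given as a predicate) is well-ordered by ≻.  For a FINITE
-- set this amounts to: ≻ is total (linear) on P (a finite linear order
-- is a well-order).
LinearOn : ∀ {n} → Rel (Fin n) 0ℓ → (Fin n → Set) → Set
LinearOn {n} _≻_ P = ∀ u v → P u → P v → u ≡ v ⊎ (u ≻ v ⊎ v ≻ u)

record IsTree {n : ℕ} (_≻_ : Rel (Fin n) 0ℓ) : Set where
  field
    irrefl   : ∀ x → ¬ (x ≻ x)
    trans    : ∀ {x y z} → x ≻ y → y ≻ z → x ≻ z
    antisym  : ∀ {x y} → x ≻ y → y ≻ x → x ≡ y
    ancestorsWellOrdered : ∀ t → LinearOn _≻_ (λ s → s ≻ t)

Maximal : ∀ {n} → Rel (Fin n) 0ℓ → Fin n → Set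
Maximal _≻_ m = ∀ s → ¬ (s ≻ m)

UniqueMaximal : ∀ {n} → Rel (Fin n) 0ℓ → Set
UniqueMaximal {n} _≻_ =
  ∃[ ρ ] (Maximal _≻_ ρ × (∀ m → Maximal _≻_ m → m ≡ ρ))

Child : ∀ {n} → Rel (Fin n) 0ℓ → Fin n → Fin n → Set
Child _≻_ x y = x ≻ y × ¬ (∃[ z ] (x ≻ z × z ≻ y))

InSub : ∀ {n} → Rel (Fin n) 0ℓ → Fin n → Fin n → Set
InSub _≻_ t s = s ≡ t ⊎ t ≻ s

module _ {n : ℕ} {_≻_ : Rel (Fin n) 0ℓ} (_≻?_ : Decidable _≻_) where

  maximal? : ∀ m → Dec (Maximal _≻_ m)
  maximal? m = all? (λ s → ¬? (s ≻? m))

  child? : ∀ x y → Dec (Child _≻_ x y)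
  child? x y = (x ≻? y) ×-dec ¬? (any? (λ z → (x ≻? z) ×-dec (z ≻? y)))

  numMaximal : ℕ
  numMaximal = length (filter maximal? (allFin n))

  numChildren : Fin n → ℕ
  numChildren x = length (filter (child? x) (allFin n))

  maxDegree : ℕ
  maxDegree = numMaximal ⊔ foldr _⊔_ 0 (map numChildren (allFin n))

  -- The algorithm GET-SUBTREES-OF-CHILDREN, instrumented with a step
  -- counter: every oracle query / element inspection costs one step,
  -- and every iteration of the while-loop costs one step.

  initS : Fin n → List (Fin n) → List (Fin n) × ℕ
  initS r [] = [] , 0
  initS r (h ∷ hs) with initS r hs
  ... | (S , c) with does (r ≻? h)
  ...   | true  = (h ∷ S) , suc c
  ...   | false = S , suc c

  scanMax : Fin n → List (Fin n) → Fin n × ℕ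
  scanMax x [] = x , 0
  scanMax x (s ∷ ss) with does (s ≻? x)
  ... | true  with scanMax s ss
  ...   | (x' , c) = x' , suc c
  scanMax x (s ∷ ss) | false with scanMax x ss
  ...   | (x' , c) = x' , suc c

  splitX : Fin n → List (Fin n) → (List (Fin n) × List (Fin n)) × ℕ
  splitX x [] = ([] , []) , 0
  splitX x (y ∷ ys) with splitX x ys
  ... | ((X , R) , c) with does (y ≟F x) | does (x ≻? y)
  ...   | true  | _     = ((y ∷ X) , R) , suc c
  ...   | false | true  = ((y ∷ X) , R) , suc c
  ...   | false | false = (X , (y ∷ R)) , suc c

  -- while S ≠ ∅ : ...   (the fuel argument bounds the number of
  -- iterations; each iteration removes at least one element of S, so
  -- fuel = |S| suffices)
  loop : ℕ → List (Fin n) → List (List (Fin n)) × ℕ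
  loop zero S = [] , 0
  loop (suc f) [] = [] , 0
  loop (suc f) (s ∷ ss) with scanMax s ss
  ... | (x , c₁) with splitX x (s ∷ ss)
  ...   | ((X , S') , c₂) with loop f S'
  ...     | (C , c₃) = (X ∷ C) , suc (c₁ + c₂ + c₃)

  getSubtreesOfChildren : Fin n → List (List (Fin n)) × ℕ
  getSubtreesOfChildren r with initS r (allFin n)
  ... | (S , c₀) with loop (length S) S
  ...   | (C , c) = C , (c₀ + c)

  output : Fin n → List (List (Fin n))
  output r = proj₁ (getSubtreesOfChildren r)

  steps : Fin n → ℕ
  steps r = proj₂ (getSubtreesOfChildren r)

IsListOfChildSubtrees : ∀ {n} → Rel (Fin n) 0ℓ → Fin n → List (List (Fin n)) → Set
IsListOfChildSubtrees {n} _≻_ r C =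
  ∃[ ks ] (Unique ks
         × (∀ y → (y ∈ ks) ⇔ Child _≻_ r y)
         × Pointwise (λ X x → ∀ y → (y ∈ X) ⇔ InSub _≻_ x y) C ks)

-- While-loop invariant: the remaining set S is a union of subtrees Sub_x of
-- children x of r (initially S is the set of all strict descendants of r).
-- The scan only ever moves upward, so it ends at an element x that is maximal
-- in S; by the invariant x is a child of r, the block X split off is exactly
-- Sub_x, and S ∖ Sub_x is again such a union, because two ancestors of a common
-- element are comparable.  One iteration costs 2|S| ≤ 2n steps and there is one
-- iteration per child of r, i.e. at most d, so the total is n + 2dn ≤ 3dn.
module Submission where

open import Defs
open import Level using (0ℓ)
open import Data.Nat using (ℕ; zero; suc; _+_; _*_; _≤_; _<_; _⊔_; z≤n; s≤s)
open import Data.Nat.Properties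
open import Data.Nat.Tactic.RingSolver using (solve-∀)
open import Data.Fin using (Fin)
open import Data.Fin.Properties using () renaming (_≟_ to _≟F_)
open import Data.Product using (_×_; ∃-syntax; _,_; proj₁; proj₂)
open import Data.Sum using (inj₁; inj₂)
open import Function.Base using (_∘_; id)
open import Data.Empty using (⊥-elim)
open import Data.List using (List; []; _∷_; length; filter; map; foldr; allFin)
open import Data.List.Properties using (length-filter; filter-notAll; length-removeAt′; length-tabulate)
open import Data.List.Relation.Unary.Any using (here; there; index; _─_)
import Data.List.Relation.Unary.Any as Any
import Data.List.Relation.Unary.All as All
open import Data.List.Relation.Unary.AllPairs using ([]; _∷_)
open import Data.List.Relation.Unary.Unique.Propositional using (Unique)
open import Data.List.Relation.Binary.Pointwise using (Pointwise; []; _∷_; Pointwise-length)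
open import Data.List.Relation.Binary.Subset.Propositional using (_⊆_)
open import Data.List.Membership.Propositional using (_∈_)
open import Data.List.Membership.Propositional.Properties using (∈-filter⁺; ∈-filter⁻; ∈-allFin; ∈-length)
open import Relation.Nullary using (¬_; yes; no)
open import Relation.Nullary.Decidable using (_⊎-dec_)
open import Relation.Unary using () renaming (Decidable to Decidable₁)
open import Relation.Unary.Properties using (∁?)
open import Relation.Binary using (Rel; Decidable)
open import Relation.Binary.PropositionalEquality using (_≡_; _≢_; refl; sym; cong; subst)
open import Function.Bundles using (_⇔_; mk⇔; Equivalence)

module _ {a} {A : Set a} where

  ∈-─ : ∀ {x y} {ys : List A} (p : x ∈ ys) → y ∈ ys → x ≢ y → y ∈ (ys ─ p)
  ∈-─ (here refl) (here refl) x≢y = ⊥-elim (x≢y refl)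
  ∈-─ (here refl) (there q)   _   = q
  ∈-─ (there p)   (here refl) _   = here refl
  ∈-─ (there p)   (there q)   x≢y = there (∈-─ p q x≢y)

  Unique⇒length≤ : ∀ {xs ys : List A} → Unique xs → xs ⊆ ys → length xs ≤ length ys
  Unique⇒length≤ {[]}     _          _   = z≤n
  Unique⇒length≤ {x ∷ xs} {ys} (x∉xs ∷ u) xs⊆ys = begin
    suc (length xs)        ≤⟨ s≤s (Unique⇒length≤ u xs⊆ys─p) ⟩
    suc (length (ys ─ p))  ≡⟨ sym (length-removeAt′ ys (index p)) ⟩
    length ys              ∎
    where
    open ≤-Reasoning
    p = xs⊆ys (here refl)
    xs⊆ys─p : xs ⊆ (ys ─ p)
    xs⊆ys─p z∈xs = ∈-─ p (xs⊆ys (there z∈xs)) (All.lookup x∉xs z∈xs)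

  ≤-foldr-⊔-map : ∀ (f : A → ℕ) {x xs} → x ∈ xs → f x ≤ foldr _⊔_ 0 (map f xs)
  ≤-foldr-⊔-map f {xs = y ∷ _}  (here refl) = m≤m⊔n (f y) _
  ≤-foldr-⊔-map f {xs = y ∷ _}  (there x∈xs) = ≤-trans (≤-foldr-⊔-map f x∈xs) (m≤n⊔m (f y) _)

m+k*2m≤3*d*m : ∀ {m k d} → k ≤ d → 1 ≤ d → m + k * (2 * m) ≤ 3 * d * m
m+k*2m≤3*d*m {m} {k} {d} k≤d 1≤d = begin
  m + k * (2 * m)          ≡⟨ cong (_+ k * (2 * m)) (sym (*-identityˡ m)) ⟩
  1 * m + k * (2 * m)      ≤⟨ +-mono-≤ (*-monoˡ-≤ m 1≤d) (*-monoˡ-≤ (2 * m) k≤d) ⟩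
  d * m + d * (2 * m)      ≡⟨ d*m+d*2m≡3*d*m d m ⟩
  3 * d * m                ∎
  where
  open ≤-Reasoning
  d*m+d*2m≡3*d*m : ∀ d m → d * m + d * (2 * m) ≡ 3 * d * m
  d*m+d*2m≡3*d*m = solve-∀

module Algorithm {n : ℕ} {_≻_ : Rel (Fin n) 0ℓ} (_≻?_ : Decidable _≻_) where

  InSub? : ∀ x → Decidable₁ (InSub _≻_ x)
  InSub? x y = (y ≟F x) ⊎-dec (x ≻? y)

  inside outside : Fin n → List (Fin n) → List (Fin n)
  inside  x = filter (InSub? x)
  outside x = filter (∁? (InSub? x))

  ∈-inside⁻ : ∀ {x y} S → y ∈ inside x S → y ∈ S × InSub _≻_ x y
  ∈-inside⁻ {x} S = ∈-filter⁻ (InSub? x) {xs = S}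

  ∈-inside⁺ : ∀ {x y S} → y ∈ S → InSub _≻_ x y → y ∈ inside x S
  ∈-inside⁺ {x} = ∈-filter⁺ (InSub? x)

  ∈-outside⁻ : ∀ {x y} S → y ∈ outside x S → y ∈ S × ¬ InSub _≻_ x y
  ∈-outside⁻ {x} S = ∈-filter⁻ (∁? (InSub? x)) {xs = S}

  ∈-outside⁺ : ∀ {x y S} → y ∈ S → ¬ InSub _≻_ x y → y ∈ outside x S
  ∈-outside⁺ {x} = ∈-filter⁺ (∁? (InSub? x))

  length-outside≤ : ∀ x S → length (outside x S) ≤ length S
  length-outside≤ x = length-filter (∁? (InSub? x))

  outside-shrinks : ∀ {x S} → x ∈ S → length (outside x S) < length S
  outside-shrinks {x} {S} x∈S = filter-notAll (∁? (InSub? x)) S (Any.map (λ { refl x∉Sub → x∉Sub (inj₁ refl) }) x∈S)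

  MaximalIn : List (Fin n) → Fin n → Set
  MaximalIn S x = ∀ {z} → z ∈ S → ¬ (z ≻ x)

  initS-filter : ∀ r hs → initS _≻?_ r hs ≡ (filter (r ≻?_) hs , length hs)
  initS-filter r [] = refl
  initS-filter r (h ∷ hs) rewrite initS-filter r hs with r ≻? h
  ... | yes _ = refl
  ... | no  _ = refl

  scanMax-∈ : ∀ x ss → proj₁ (scanMax _≻?_ x ss) ∈ x ∷ ss
  scanMax-∈ x [] = here refl
  scanMax-∈ x (s ∷ ss) with s ≻? x
  ... | yes _ = there (scanMax-∈ s ss)
  ... | no  _ with scanMax-∈ x ss
  ...   | here  eq = here eq
  ...   | there p  = there (there p)

  scanMax-steps : ∀ x ss → proj₂ (scanMax _≻?_ x ss) ≡ length ss
  scanMax-steps x [] = refl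
  scanMax-steps x (s ∷ ss) with s ≻? x
  ... | yes _ = cong suc (scanMax-steps s ss)
  ... | no  _ = cong suc (scanMax-steps x ss)

  splitX-partition : ∀ x S → splitX _≻?_ x S ≡ ((inside x S , outside x S) , length S)
  splitX-partition x [] = refl
  splitX-partition x (y ∷ ys) rewrite splitX-partition x ys with y ≟F x | x ≻? y
  ... | yes _ | _     = refl
  ... | no  _ | yes _ = refl
  ... | no  _ | no  _ = refl

  loop-step : ∀ f s ss →
    let S = s ∷ ss ; x = proj₁ (scanMax _≻?_ s ss) ; rest = loop _≻?_ f (outside x S) in
    loop _≻?_ (suc f) S ≡ (inside x S ∷ proj₁ rest , suc (length ss + length S + proj₂ rest))
  loop-step f s ss
    rewrite scanMax-steps s ss | splitX-partition (proj₁ (scanMax _≻?_ s ss)) (s ∷ ss) = refl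

  initial : Fin n → List (Fin n)
  initial r = filter (r ≻?_) (allFin n)

  length-initial≤ : ∀ r → length (initial r) ≤ n
  length-initial≤ r = ≤-trans (length-filter (r ≻?_) (allFin n)) (≤-reflexive (length-tabulate id))

  getSubtreesOfChildren-unfold : ∀ r → let S = initial r in
    getSubtreesOfChildren _≻?_ r ≡ (proj₁ (loop _≻?_ (length S) S) , length (allFin n) + proj₂ (loop _≻?_ (length S) S))
  getSubtreesOfChildren-unfold r rewrite initS-filter r (allFin n) = refl

  loop-steps : ∀ f S → proj₂ (loop _≻?_ f S) ≤ length (proj₁ (loop _≻?_ f S)) * (2 * length S)
  loop-steps zero    S        = z≤n
  loop-steps (suc f) []       = z≤n
  loop-steps (suc f) (s ∷ ss) =
    subst (λ res → proj₂ res ≤ length (proj₁ res) * (2 * length (s ∷ ss))) (sym (loop-step f s ss)) (begin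
    suc m + suc m + proj₂ rest   ≡⟨ cong (λ k → suc m + k + proj₂ rest) (sym (+-identityʳ (suc m))) ⟩
    2 * suc m + proj₂ rest       ≤⟨ +-monoʳ-≤ (2 * suc m) (loop-steps f R) ⟩
    2 * suc m + k * (2 * length R)
      ≤⟨ +-monoʳ-≤ (2 * suc m) (*-monoʳ-≤ k (*-monoʳ-≤ 2 (length-outside≤ x (s ∷ ss)))) ⟩
    2 * suc m + k * (2 * suc m)  ∎)
    where
    open ≤-Reasoning
    m = length ss
    x = proj₁ (scanMax _≻?_ s ss)
    R = outside x (s ∷ ss)
    rest = loop _≻?_ f R
    k = length (proj₁ rest)

  output≡loop : ∀ r → output _≻?_ r ≡ proj₁ (loop _≻?_ (length (initial r)) (initial r))
  output≡loop r = cong proj₁ (getSubtreesOfChildren-unfold r)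

  steps≤ : ∀ r → steps _≻?_ r ≤ n + length (output _≻?_ r) * (2 * n)
  steps≤ r = begin
    steps _≻?_ r                                  ≡⟨ cong proj₂ (getSubtreesOfChildren-unfold r) ⟩
    length (allFin n) + proj₂ L                   ≡⟨ cong (_+ proj₂ L) (length-tabulate id) ⟩
    n + proj₂ L                                   ≤⟨ +-monoʳ-≤ n (loop-steps (length S) S) ⟩
    n + length (proj₁ L) * (2 * length S)         ≤⟨ +-monoʳ-≤ n (*-monoʳ-≤ (length (proj₁ L)) (*-monoʳ-≤ 2 (length-initial≤ r))) ⟩
    n + length (proj₁ L) * (2 * n)                ≡⟨ cong (λ C → n + length C * (2 * n)) (sym (output≡loop r)) ⟩
    n + length (output _≻?_ r) * (2 * n)          ∎
    where
    open ≤-Reasoning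
    S = initial r
    L = loop _≻?_ (length S) S

  1≤maxDegree : ∀ {ρ} → Maximal _≻_ ρ → 1 ≤ maxDegree _≻?_
  1≤maxDegree {ρ} ρ-max = ≤-trans (∈-length (∈-filter⁺ (maximal? _≻?_) (∈-allFin ρ) ρ-max)) (m≤m⊔n _ _)

  numChildren≤maxDegree : ∀ r → numChildren _≻?_ r ≤ maxDegree _≻?_
  numChildren≤maxDegree r = ≤-trans (≤-foldr-⊔-map (numChildren _≻?_) (∈-allFin r)) (m≤n⊔m _ _)

module InTree {n : ℕ} {_≻_ : Rel (Fin n) 0ℓ} (_≻?_ : Decidable _≻_) (T : IsTree _≻_) where
  open IsTree T
  open Algorithm _≻?_

  InSub-≻ : ∀ {t s u} → InSub _≻_ t s → s ≻ u → t ≻ u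
  InSub-≻ (inj₁ refl) s≻u = s≻u
  InSub-≻ (inj₂ t≻s)  s≻u = trans t≻s s≻u

  ≻-InSub : ∀ {z t s} → z ≻ t → InSub _≻_ t s → z ≻ s
  ≻-InSub z≻t (inj₁ refl) = z≻t
  ≻-InSub z≻t (inj₂ t≻s)  = trans z≻t t≻s

  scanMax-above : ∀ x ss → InSub _≻_ (proj₁ (scanMax _≻?_ x ss)) x
  scanMax-above x [] = inj₁ refl
  scanMax-above x (s ∷ ss) with s ≻? x
  ... | yes s≻x = inj₂ (InSub-≻ (scanMax-above s ss) s≻x)
  ... | no  _   = scanMax-above x ss

  scanMax-maximal : ∀ x ss → MaximalIn (x ∷ ss) (proj₁ (scanMax _≻?_ x ss))
  scanMax-maximal x ss       (here refl) z≻x′ = irrefl x (≻-InSub z≻x′ (scanMax-above x ss))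
  scanMax-maximal x (s ∷ ss) (there z∈)  z≻x′ with s ≻? x
  ... | yes _   = scanMax-maximal s ss z∈ z≻x′
  ... | no  s⊁x with z∈
  ...   | here refl = s⊁x (≻-InSub z≻x′ (scanMax-above x ss))
  ...   | there z∈′ = scanMax-maximal x ss (there z∈′) z≻x′

  child-InSub⇒≡ : ∀ {r x y} → Child _≻_ r y → r ≻ x → InSub _≻_ x y → y ≡ x
  child-InSub⇒≡ _         _   (inj₁ y≡x) = y≡x
  child-InSub⇒≡ {x = x} (_ , ¬mid) r≻x (inj₂ x≻y) = ⊥-elim (¬mid (x , r≻x , x≻y))

  record Closed (r : Fin n) (S : List (Fin n)) : Set where
    field
      below             : ∀ {y} → y ∈ S → r ≻ y
      ancestor-closed   : ∀ {y z} → y ∈ S → r ≻ z → z ≻ y → z ∈ S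
      descendant-closed : ∀ {y z} → y ∈ S → y ≻ z → z ∈ S

  module _ {r S} (cl : Closed r S) where
    open Closed cl

    maximal⇒child : ∀ {x} → x ∈ S → MaximalIn S x → Child _≻_ r x
    maximal⇒child x∈S max = below x∈S , λ (z , r≻z , z≻x) → max (ancestor-closed x∈S r≻z z≻x) z≻x

    InSub⇒∈ : ∀ {x y} → x ∈ S → InSub _≻_ x y → y ∈ S
    InSub⇒∈ x∈S (inj₁ refl) = x∈S
    InSub⇒∈ x∈S (inj₂ x≻y)  = descendant-closed x∈S x≻y

    Closed-outside : ∀ {x} → MaximalIn S x → Closed r (outside x S)
    Closed-outside {x} max = record
      { below             = below ∘ proj₁ ∘ ∈-outside⁻ S
      ; ancestor-closed   = λ y∈R r≻z z≻y → let (y∈S , y∉Sub) = ∈-outside⁻ S y∈R in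
          ∈-outside⁺ (ancestor-closed y∈S r≻z z≻y) (λ z∈Sub → y∉Sub (inj₂ (InSub-≻ z∈Sub z≻y)))
      ; descendant-closed = λ y∈R y≻z → let (y∈S , y∉Sub) = ∈-outside⁻ S y∈R in
          ∈-outside⁺ (descendant-closed y∈S y≻z) (z∉Sub y∈S y∉Sub y≻z)
      }
      where
      -- x and y are both ancestors of z, hence comparable.
      z∉Sub : ∀ {y z} → y ∈ S → ¬ InSub _≻_ x y → y ≻ z → ¬ InSub _≻_ x z
      z∉Sub y∈S y∉Sub y≻z (inj₁ refl) = max y∈S y≻z
      z∉Sub {y} {z} y∈S y∉Sub y≻z (inj₂ x≻z) with ancestorsWellOrdered z x y x≻z y≻z
      ... | inj₁ x≡y        = y∉Sub (inj₁ (sym x≡y))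
      ... | inj₂ (inj₁ x≻y) = y∉Sub (inj₂ x≻y)
      ... | inj₂ (inj₂ y≻x) = max y∈S y≻x

  _IsSubtreeOf_ : List (Fin n) → Fin n → Set
  X IsSubtreeOf x = ∀ y → (y ∈ X) ⇔ InSub _≻_ x y

  ChildSubtreesWithin : Fin n → List (Fin n) → List (List (Fin n)) → Set
  ChildSubtreesWithin r S C =
    ∃[ ks ] (Unique ks × (∀ y → (y ∈ ks) ⇔ (Child _≻_ r y × y ∈ S)) × Pointwise _IsSubtreeOf_ C ks)

  ChildSubtreesWithin-∷ : ∀ {r x S C} → Closed r S → x ∈ S → MaximalIn S x →
    ChildSubtreesWithin r (outside x S) C → ChildSubtreesWithin r S (inside x S ∷ C)
  ChildSubtreesWithin-∷ {r} {x} {S} cl x∈S max (ks , u , ks⇔ , pw) =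
    x ∷ ks , All.tabulate x≢ ∷ u , x∷ks⇔ , inside-IsSubtree ∷ pw
    where
    open Closed cl
    x≢ : ∀ {w} → w ∈ ks → x ≢ w
    x≢ w∈ks refl = proj₂ (∈-outside⁻ S (proj₂ (Equivalence.to (ks⇔ x) w∈ks))) (inj₁ refl)
    x∷ks⇔ : ∀ y → (y ∈ x ∷ ks) ⇔ (Child _≻_ r y × y ∈ S)
    x∷ks⇔ y = mk⇔ to from
      where
      to : y ∈ x ∷ ks → Child _≻_ r y × y ∈ S
      to (here refl)  = maximal⇒child cl x∈S max , x∈S
      to (there y∈ks) = let (ry , y∈R) = Equivalence.to (ks⇔ y) y∈ks in ry , proj₁ (∈-outside⁻ S y∈R)
      from : Child _≻_ r y × y ∈ S → y ∈ x ∷ ks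
      from (ry , y∈S) with y ≟F x
      ... | yes y≡x = here y≡x
      ... | no  y≢x = there (Equivalence.from (ks⇔ y)
                        (ry , ∈-outside⁺ y∈S (y≢x ∘ child-InSub⇒≡ ry (below x∈S))))
    inside-IsSubtree : inside x S IsSubtreeOf x
    inside-IsSubtree y = mk⇔ (proj₂ ∘ ∈-inside⁻ S) (λ y∈Sub → ∈-inside⁺ (InSub⇒∈ cl x∈S y∈Sub) y∈Sub)

  loop-correct : ∀ {r} f S → Closed r S → length S ≤ f → ChildSubtreesWithin r S (proj₁ (loop _≻?_ f S))
  loop-correct zero    []       _  _  = [] , [] , (λ _ → mk⇔ (λ ()) (λ ())) , []
  loop-correct (suc f) []       _  _  = [] , [] , (λ _ → mk⇔ (λ ()) (λ ())) , []
  loop-correct {r} (suc f) (s ∷ ss) cl (s≤s ss≤f) =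
    subst (ChildSubtreesWithin r S ∘ proj₁) (sym (loop-step f s ss))
      (ChildSubtreesWithin-∷ cl x∈S max (loop-correct f (outside x S) (Closed-outside cl max) R≤f))
    where
    S = s ∷ ss
    x = proj₁ (scanMax _≻?_ s ss)
    x∈S = scanMax-∈ s ss
    max : MaximalIn S x
    max = scanMax-maximal s ss
    R≤f : length (outside x S) ≤ f
    R≤f = ≤-trans (≤-pred (outside-shrinks x∈S)) ss≤f

  Closed-initial : ∀ r → Closed r (initial r)
  Closed-initial r = record
    { below             = r≻
    ; ancestor-closed   = λ _ r≻z _ → ∈initial r≻z
    ; descendant-closed = λ y∈S y≻z → ∈initial (trans (r≻ y∈S) y≻z)
    }
    where
    r≻ : ∀ {y} → y ∈ initial r → r ≻ y
    r≻ = proj₂ ∘ ∈-filter⁻ (r ≻?_) {xs = allFin n}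
    ∈initial : ∀ {y} → r ≻ y → y ∈ initial r
    ∈initial {y} = ∈-filter⁺ (r ≻?_) (∈-allFin y)

  output-correct : ∀ r → IsListOfChildSubtrees _≻_ r (output _≻?_ r)
  output-correct r with subst (ChildSubtreesWithin r (initial r)) (sym (output≡loop r))
                           (loop-correct _ (initial r) (Closed-initial r) ≤-refl)
  ... | ks , u , ks⇔ , pw = ks , u , ks⇔child , pw
    where
    ks⇔child : ∀ y → (y ∈ ks) ⇔ Child _≻_ r y
    ks⇔child y = mk⇔ (proj₁ ∘ Equivalence.to (ks⇔ y))
                     (λ ry → Equivalence.from (ks⇔ y) (ry , ∈-filter⁺ (r ≻?_) (∈-allFin y) (proj₁ ry)))

  length-output≤numChildren : ∀ r → length (output _≻?_ r) ≤ numChildren _≻?_ r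
  length-output≤numChildren r with output-correct r
  ... | ks , u , ks⇔ , pw = begin
    length (output _≻?_ r)  ≡⟨ Pointwise-length pw ⟩
    length ks               ≤⟨ Unique⇒length≤ u ks⊆children ⟩
    numChildren _≻?_ r      ∎
    where
    open ≤-Reasoning
    ks⊆children : ks ⊆ filter (child? _≻?_ r) (allFin n)
    ks⊆children {y} y∈ks = ∈-filter⁺ (child? _≻?_ r) (∈-allFin y) (Equivalence.to (ks⇔ y) y∈ks)

lemma2 : ∃[ c ] ((n : ℕ) (_≻_ : Rel (Fin n) 0ℓ) (_≻?_ : Decidable _≻_)
    → IsTree _≻_ → UniqueMaximal _≻_ → (r : Fin n)
    → IsListOfChildSubtrees _≻_ r (output _≻?_ r)
    × steps _≻?_ r ≤ c * maxDegree _≻?_ * n)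
lemma2 = 3 , λ n _≻_ _≻?_ tree (ρ , ρ-max , _) r →
  let open Algorithm _≻?_ ; open InTree _≻?_ tree in
  output-correct r ,
  ≤-trans (steps≤ r)
    (m+k*2m≤3*d*m (≤-trans (length-output≤numChildren r) (numChildren≤maxDegree r)) (1≤maxDegree ρ-max))
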